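{- $\mathcal{ED}_{fin}\not\le_K fin^\alpha$ for every $\alpha<\omega_1$. In particular, every Shelah ultrafilter is an $\mathcal{ED}_{fin}$-ultrafilter.
   Context: An ideal on a countable set $X$ is a family of subsets closed under subsets and finite unions; for a filter $\mathcal U$, $\mathcal U^*$ is its dual ideal. Ideals $\mathcal I$ on $X$ and $\mathcal J$ on $Y$ are isomorphic if there is a bijection $f:X\to Y$ with $f[A]\in\mathcal J\iff A\in\mathcal I$. $\mathcal I\le_K\mathcal J$ if there is $f:Y\to X$ with $f^{ -1}[I]\in\mathcal J$ for all $I\in\mathcal I$; Katětov equivalent means both directions. For an ideal $\mathcal I$ on $X$ and ideals $\mathcal J_i$ on $Y_i$, $\lim_{i\to\mathcal I}\mathcal J_i$ is the ideal on $\bigcup_i\{i\}\times Y_i$ of all $A$ with $\{i:A(i)\notin\mathcal J_i\}\in\mathcal I$ ($A(i)=\{y:(i,y)\in A\}$); $\mathcal I\times\mathcal J$ is the case $\mathcal J_i=\mathcal J$. $bnd(\alpha)$ is the ideal of bounded subsets of a countable limit $\alpha$. $fin^\alpha$ on $X_\alpha$: $X_0=\{0\}$, $fin^0=\{\emptyset\}$; $X_1=\omega$, $fin^1=fin$; $X_{\alpha+1}=\omega\times X_\alpha$, $fin^{\alpha+1}=fin\times fin^\alpha$; limit $\alpha$: $X_\alpha=\bigcup_{\beta<\alpha}\{\beta\}\times X_\beta$, $fin^\alpha=\lim_{\beta\to bnd(\alpha)}fin^\beta$. $\mathcal{ED}$ is the ideal on $\omega\times\omega$ of all $A$ with $m,n$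 such that $|\{l:(k,l)\in A\}|<m$ for all $k>n$; $\Delta=\{(n,m):m\le n\}$; $\mathcal{ED}_{fin}=\{A\cap\Delta:A\in\mathcal{ED}\}$. An ultrafilter $\mathcal U$ on $\omega$ is a Shelah ultrafilter if (1) for every $\alpha<\omega_1$ there is an ideal $\mathcal I$ isomorphic to $fin^\alpha$ with $\mathcal I\subseteq\mathcal U^*$; (2) for every analytic ideal $\mathcal I$ with $\mathcal I\cap\mathcal U=\emptyset$ there are $\alpha<\omega_1$ and an ideal $\mathcal J$ Katětov equivalent to $fin^\alpha$ with $\mathcal I\subseteq\mathcal J\subseteq\mathcal U^*$. For an ideal $\mathcal I$ on $X$, an ultrafilter $\mathcal U$ on $Y$ is an $\mathcal I$-ultrafilter if for every $f:Y\to X$ there is $U\in\mathcal U$ with $f[U]\in\mathcal I$. -}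

module Defs where

open import Level using (Level; _⊔_) renaming (suc to lsuc; zero to lzero)
open import Data.Nat using (ℕ; _≤_; _<_)
open import Data.Fin using (Fin)
open import Data.Bool using (Bool; true)
open import Data.Unit using (⊤)
open import Data.Product using (Σ; ∃; _×_; _,_; proj₁)
open import Data.Sum using (_⊎_)
open import Relation.Nullary using (¬_)
open import Relation.Binary.PropositionalEquality using (_≡_)
open import Relation.Binary.Definitions using (Transitive)
open import Induction.WellFounded using (Acc; acc; WellFounded)
open import Function.Definitions using (Injective)
open import Function.Bundles using (_⇔_; _⤖_; Bijection)

Subset : Set → Set₁
Subset X = X → Set

_⊆_ : {X : Set} → Subset X → Subset X → Set
A ⊆ B = ∀ x → A x → B x

_∪_ : {X : Set} → Subset X → Subset X → Subset X
(A ∪ B) x = A x ⊎ B x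

∅ : {X : Set} → Subset X
∅ _ = Data.Empty.⊥
  where import Data.Empty

full : {X : Set} → Subset X
full _ = ⊤

∁ : {X : Set} → Subset X → Subset X
∁ A x = ¬ A x

Image : {X Y : Set} → (X → Y) → Subset X → Subset Y
Image f A y = Σ _ λ x → A x × f x ≡ y

_⊑_ : {X : Set} {ℓ₁ ℓ₂ : Level} → (Subset X → Set ℓ₁) → (Subset X → Set ℓ₂) → Set (lsuc lzero ⊔ ℓ₁ ⊔ ℓ₂)
I ⊑ J = ∀ A → I A → J A

IsIdeal : {X : Set} {ℓ : Level} → (Subset X → Set ℓ) → Set (lsuc lzero ⊔ ℓ)
IsIdeal I = (∀ A B → A ⊆ B → I B → I A) × I ∅ × (∀ A B → I A → I B → I (A ∪ B))

_≤K_ : {X Y : Set} {ℓ₁ ℓ₂ : Level} → (Subset X → Set ℓ₁) → (Subset Y → Set ℓ₂) → Set (lsuc lzero ⊔ ℓ₁ ⊔ ℓ₂)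
_≤K_ {X} {Y} I J = Σ (Y → X) λ f → ∀ (A : Subset X) → I A → J (λ y → A (f y))

KatetovEquiv : {X Y : Set} {ℓ₁ ℓ₂ : Level} → (Subset X → Set ℓ₁) → (Subset Y → Set ℓ₂) → Set (lsuc lzero ⊔ ℓ₁ ⊔ ℓ₂)
KatetovEquiv I J = (I ≤K J) × (J ≤K I)

Isomorphic : {X Y : Set} {ℓ₁ ℓ₂ : Level} → (Subset X → Set ℓ₁) → (Subset Y → Set ℓ₂) → Set (lsuc lzero ⊔ ℓ₁ ⊔ ℓ₂)
Isomorphic {X} {Y} I J = Σ (X ⤖ Y) λ b → ∀ (A : Subset X) → J (Image (Bijection.to b) A) ⇔ I A

finI : Subset ℕ → Set
finI A = Σ ℕ λ n → ∀ k → A k → k < n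

-- |B| < m : B has no m pairwise distinct elements
FewerThan : ℕ → Subset ℕ → Set
FewerThan m B = (g : Fin m → ℕ) → Injective _≡_ _≡_ g → ¬ (∀ i → B (g i))

ED : Subset (ℕ × ℕ) → Set
ED A = Σ ℕ λ m → Σ ℕ λ n → ∀ k → n < k → FewerThan m (λ l → A (k , l))

Δ : Set
Δ = Σ (ℕ × ℕ) λ p → proj₁' p
  where
  proj₁' : ℕ × ℕ → Set
  proj₁' (n , m) = m ≤ n

-- ED_fin = { A ∩ Δ : A ∈ ED }, an ideal on Δ
EDfin : Subset Δ → Set₁
EDfin B = Σ (Subset (ℕ × ℕ)) λ A → ED A × (∀ (p : Δ) → B p ⇔ A (proj₁ p))

-- Countable ordinals, presented as countable well-orders with a top
-- element; the ordinal α represented is the order type of {y : y ≺ top}.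

data Kind {C : Set} (_≺_ : C → C → Set) (x : C) : Set where
  isZero : (∀ y → ¬ (y ≺ x)) → Kind _≺_ x
  isSuc  : (y : C) → y ≺ x → (∀ z → z ≺ x → z ≺ y ⊎ z ≡ y) → Kind _≺_ x
  isLim  : (Σ C λ y → y ≺ x) → (∀ y → y ≺ x → Σ C λ z → y ≺ z × z ≺ x) → Kind _≺_ x

record CountableOrdinal : Set₁ where
  field
    Carrier : Set
    _≺_     : Carrier → Carrier → Set
    ≺-trans : Transitive _≺_
    ≺-tri   : ∀ x y → x ≺ y ⊎ x ≡ y ⊎ y ≺ x
    ≺-irr   : ∀ x → ¬ (x ≺ x)
    ≺-wf    : WellFounded _≺_
    enc     : Carrier → ℕ
    enc-inj : Injective _≡_ _≡_ enc
    top     : Carrier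
    top-max : ∀ x → x ≺ top ⊎ x ≡ top
    kind    : (x : Carrier) → Kind _≺_ x

module FinHierarchy (α : CountableOrdinal) where
  open CountableOrdinal α

  -- X_β for β = order type of {y : y ≺ x}
  X : (x : Carrier) → Acc _≺_ x → Set
  X x (acc rs) with kind x
  ... | isZero _ = ⊤
  ... | isLim _ _ = Σ (Σ Carrier λ y → y ≺ x) λ yp → X (proj₁ yp) (rs (Data.Product.proj₂ yp))
  ... | isSuc y p _ with kind y
  ...   | isZero _ = ℕ
  ...   | isSuc _ _ _ = ℕ × X y (rs p)
  ...   | isLim _ _ = ℕ × X y (rs p)

  bnd : (x : Carrier) → Subset (Σ Carrier λ y → y ≺ x) → Set
  bnd x B = Σ Carrier λ z → z ≺ x × (∀ yp → B yp → proj₁ yp ≺ z)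

  FinI : (x : Carrier) → (a : Acc _≺_ x) → Subset (X x a) → Set
  FinI x (acc rs) with kind x
  ... | isZero _ = λ A → ∀ u → ¬ A u
  ... | isLim _ _ = λ A → bnd x (λ yp → ¬ FinI (proj₁ yp) (rs (Data.Product.proj₂ yp)) (λ u → A (yp , u)))
  ... | isSuc y p _ with kind y
  ...   | isZero _ = finI
  ...   | isSuc _ _ _ = λ A → finI (λ n → ¬ FinI y (rs p) (λ u → A (n , u)))
  ...   | isLim _ _ = λ A → finI (λ n → ¬ FinI y (rs p) (λ u → A (n , u)))

Xα : CountableOrdinal → Set
Xα α = FinHierarchy.X α (CountableOrdinal.top α) (CountableOrdinal.≺-wf α (CountableOrdinal.top α))

finα : (α : CountableOrdinal) → Subset (Xα α) → Set
finα α = FinHierarchy.FinI α (CountableOrdinal.top α) (CountableOrdinal.≺-wf α (CountableOrdinal.top α))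

NonZeroOrd : CountableOrdinal → Set
NonZeroOrd α = Σ (CountableOrdinal.Carrier α) λ y → CountableOrdinal._≺_ α y (CountableOrdinal.top α)

IsUltrafilter : (Subset ℕ → Set₁) → Set₁
IsUltrafilter U =
  (∀ A B → A ⊆ B → U A → U B) × (∀ A B → U A → U B → U (λ n → A n × B n)) ×
  U full × ¬ U ∅ × (∀ A → U A ⊎ U (∁ A))

Dual : (Subset ℕ → Set₁) → Subset ℕ → Set₁
Dual U A = U (∁ A)

Continuous : ((ℕ → ℕ) → (ℕ → Bool)) → Set
Continuous F = ∀ x n → Σ ℕ λ m → ∀ y → (∀ i → i < m → x i ≡ y i) → F x n ≡ F y n

-- analytic family of subsets of ω (nonempty analytic: continuous image of ω^ω,
-- subsets of ω identified with points of 2^ω)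
Analytic : (Subset ℕ → Set₁) → Set₁
Analytic I = Σ ((ℕ → ℕ) → (ℕ → Bool)) λ F → Continuous F ×
  (∀ (A : Subset ℕ) → I A ⇔ (Σ (ℕ → ℕ) λ x → ∀ n → A n ⇔ (F x n ≡ true)))

IsShelah : (Subset ℕ → Set₁) → Set₂
IsShelah U =
  IsUltrafilter U ×
  (∀ (α : CountableOrdinal) → NonZeroOrd α →
     Σ (Subset ℕ → Set₁) λ I → IsIdeal I × Isomorphic I (finα α) × I ⊑ Dual U) ×
  (∀ (I : Subset ℕ → Set₁) → IsIdeal I → Analytic I → (∀ A → I A → ¬ U A) →
     Σ CountableOrdinal λ α → Σ (Subset ℕ → Set₁) λ J →
       IsIdeal J × KatetovEquiv J (finα α) × I ⊑ J × J ⊑ Dual U)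

IsIUltrafilter : {X : Set} {ℓ : Level} → (Subset X → Set ℓ) → (Subset ℕ → Set₁) → Set (lsuc lzero ⊔ ℓ)
IsIUltrafilter {X} I U = ∀ (f : ℕ → X) → Σ (Subset ℕ) λ A → U A × I (Image f A)

-- A property T of subsets of Δ is forced if it holds of some singleton, or of every set meeting each of
-- countably many sequences with unbounded columns infinitely often; a forced property holds of a selector
-- (at most one point per column), and selectors lie in ED_fin. Call J selector-forcing if for every
-- J-positive P and g : X → Δ the property "P ∩ g⁻¹[S] is J-positive" is forced. The ideal {∅} is
-- selector-forcing, and so is every limit of selector-forcing ideals along a countably generated ideal
-- such as fin or bnd(α): if positively many indices are forced by sequences, merge countably many of
-- these families; if positively many are forced by points, either one point already works or, for each
-- generator of the ideal, the points can be taken outside it and in columns tending to infinity.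
-- By induction every fin^α is selector-forcing, so no map is a Katětov reduction of ED_fin to fin^α.
--
-- For a Shelah ultrafilter U and f : ω → Δ, if no set of U had an image in ED_fin, the ideal
-- {A : f[A] ∈ ED_fin} would be analytic (A is coded by its ED-bounds and its characteristic function;
-- whether the column of f(n) respects the bound can be read off the members j ≤ n) and disjoint from U,
-- hence contained in an ideal Katětov equivalent to some fin^α, which would give ED_fin ≤K fin^α.

module Submission where

open import Defs
open import Level using (Level)
open import Axiom.ExcludedMiddle using (ExcludedMiddle)
open import Axiom.DoubleNegationElimination using (em⇒dne)
open import Data.Nat using (ℕ; zero; suc; _+_; _⊔_; _≤_; _<_; z≤n; s≤s; _≤?_)
open import Data.Nat.Properties
open import Data.Product using (Σ; _×_; _,_; proj₁; proj₂)
open import Data.Product.Properties using (,-injectiveʳ)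
open import Data.Sum as Sum using (_⊎_; inj₁; inj₂)
open import Data.Empty using (⊥-elim)
open import Data.Unit using (⊤; tt)
open import Relation.Nullary using (¬_; Dec; yes; no; does)
open import Relation.Nullary.Decidable using (dec-true; does-⇔)
open import Data.Bool using (Bool; true)
open import Data.List using (allFin)
import Data.List.Relation.Unary.All as All
open import Data.List.Membership.Propositional.Properties using (∈-allFin)
open import Data.List.Extrema.Nat using (argmax; f[xs]≤f[argmax])
open import Relation.Binary.Definitions using (tri<; tri≈; tri>)
open import Relation.Binary.PropositionalEquality using (_≡_; refl; sym; trans; cong; subst; subst₂)
open import Induction.WellFounded using (Acc; acc)
open import Data.Fin as Fin using (Fin)
import Data.Fin.Properties as Fin
open import Function using (id)
open import Function.Bundles using (_⇔_; mk⇔; Equivalence)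
open import Function.Definitions using (Injective)

next : ℕ × ℕ → ℕ × ℕ
next (a , zero)  = zero , suc a
next (a , suc b) = suc a , b

unpair : ℕ → ℕ × ℕ
unpair zero    = 0 , 0
unpair (suc m) = next (unpair m)

unpair-surjective : ∀ p → Σ ℕ λ m → unpair m ≡ p
unpair-surjective (a , b) = onDiagonal (a + b) a b refl
  where
  onDiagonal : ∀ s a b → a + b ≡ s → Σ ℕ λ m → unpair m ≡ (a , b)
  onDiagonal _       zero    zero    _ = 0 , refl
  onDiagonal zero    zero    (suc b) ()
  onDiagonal (suc s) zero    (suc b) e with onDiagonal s b zero (trans (+-identityʳ b) (suc-injective e))
  ... | m , eq = suc m , cong next eq
  onDiagonal s       (suc a) b       e with onDiagonal s a (suc b) (trans (+-suc a b) e)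
  ... | m , eq = suc m , cong next eq

Pt : Set
Pt = ℕ × ℕ

column : Pt → ℕ
column = proj₁

InΔ : Pt → Set
InΔ (k , l) = l ≤ k

Δ-≡ : {p q : Δ} → proj₁ p ≡ proj₁ q → p ≡ q
Δ-≡ {_ , d} {_ , d′} refl = cong (_ ,_) (≤-irrelevant d d′)

Singleton : Pt → Subset Pt
Singleton p q = q ≡ p

Selector : Subset Pt → Set
Selector S = ∀ k l l′ → S (k , l) → S (k , l′) → l ≡ l′

singleton-selector : ∀ p → Selector (Singleton p)
singleton-selector p k l l′ refl eq = sym (,-injectiveʳ eq)

MeetsInfinitelyOften : (ℕ → ℕ → Pt) → Subset Pt → Set
MeetsInfinitelyOften R S = ∀ i b → Σ ℕ λ t → b ≤ t × S (R i t)

ForcedByPoint : (Subset Pt → Set) → Set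
ForcedByPoint T = Σ Pt λ p → InΔ p × T (Singleton p)

ForcedBySequences : (Subset Pt → Set) → Set₁
ForcedBySequences T =
  Σ (ℕ → ℕ → Pt) λ R → (∀ i t → t ≤ column (R i t)) × (∀ S → MeetsInfinitelyOften R S → T S)

Forced : (Subset Pt → Set) → Set₁
Forced T = ForcedByPoint T ⊎ ForcedBySequences T

ForcedBySequences-⋂ : {T : ℕ → Subset Pt → Set} →
  (∀ j → ForcedBySequences (T j)) → ForcedBySequences (λ S → ∀ j → T j S)
ForcedBySequences-⋂ {T} F = R , R-column , forces
  where
  R : ℕ → ℕ → Pt
  R i = proj₁ (F (proj₁ (unpair i))) (proj₂ (unpair i))
  R-column : ∀ i t → t ≤ column (R i t)
  R-column i = proj₁ (proj₂ (F (proj₁ (unpair i)))) (proj₂ (unpair i))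
  forces : ∀ S → MeetsInfinitelyOften R S → ∀ j → T j S
  forces S meets j = proj₂ (proj₂ (F j)) S meetsⱼ
    where
    meetsⱼ : MeetsInfinitelyOften (proj₁ (F j)) S
    meetsⱼ k b with unpair-surjective (j , k)
    ... | i , refl = meets i b

module _ (R : ℕ → ℕ → Pt) (R-column : ∀ i t → t ≤ column (R i t)) where

  -- Running through all pairs (i , b), step m takes a point of R i beyond position b and strictly to the
  -- right of every earlier choice.
  private
    start : ℕ → ℕ
    start zero    = 0
    start (suc m) = proj₂ (unpair (suc m)) ⊔ suc (column (R (proj₁ (unpair m)) (start m)))

    chosen : ℕ → Pt
    chosen m = R (proj₁ (unpair m)) (start m)

    start-≥ : ∀ m → proj₂ (unpair m) ≤ start m
    start-≥ zero    = z≤n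
    start-≥ (suc m) = m≤m⊔n _ _

    column-step : ∀ m → column (chosen m) < column (chosen (suc m))
    column-step m = ≤-trans (m≤n⊔m _ _) (R-column _ (start (suc m)))

    column-strictMono : ∀ {m n} → m < n → column (chosen m) < column (chosen n)
    column-strictMono {m} {suc n} m<1+n with m<1+n⇒m<n∨m≡n m<1+n
    ... | inj₁ m<n  = <-trans (column-strictMono m<n) (column-step n)
    ... | inj₂ refl = column-step m

  Chosen : Subset Pt
  Chosen p = Σ ℕ λ m → chosen m ≡ p

  Chosen-selector : Selector Chosen
  Chosen-selector k l l′ (m , eq) (m′ , eq′) with <-cmp m m′
  ... | tri< m<m′ _ _ = ⊥-elim (<-irrefl (trans (cong column eq) (sym (cong column eq′))) (column-strictMono m<m′))
  ... | tri≈ _ refl _ = ,-injectiveʳ (trans (sym eq) eq′)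
  ... | tri> _ _ m′<m = ⊥-elim (<-irrefl (trans (cong column eq′) (sym (cong column eq))) (column-strictMono m′<m))

  Chosen-meets : MeetsInfinitelyOften R Chosen
  Chosen-meets i b with unpair-surjective (i , b)
  ... | m , refl = start m , start-≥ m , m , refl

Forced⇒selector : {T : Subset Pt → Set} → Forced T → Σ (Subset Pt) λ S → Selector S × T S
Forced⇒selector (inj₁ (p , _ , forced)) = Singleton p , singleton-selector p , forced
Forced⇒selector (inj₂ (R , R-column , forced)) =
  Chosen R R-column , Chosen-selector R R-column , forced _ (Chosen-meets R R-column)

selector-ED : ∀ {S} → Selector S → ED S
selector-ED S-selector = 2 , 0 , λ k _ rows rows-injective in-S →
  0≢1 (rows-injective (S-selector k _ _ (in-S Fin.zero) (in-S (Fin.suc Fin.zero))))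
  where
  0≢1 : ¬ (Fin.zero {1} ≡ Fin.suc Fin.zero)
  0≢1 ()

selector-EDfin : ∀ {S} → Selector S → EDfin (λ q → S (proj₁ q))
selector-EDfin {S} S-selector = S , selector-ED S-selector , λ _ → mk⇔ id id

record CountablyGeneratedIdeal {I : Set} (Small : Subset I → Set) : Set₁ where
  field
    ⊆-closed      : ∀ {A B} → A ⊆ B → Small B → Small A
    ∪-closed      : ∀ {A B} → Small A → Small B → Small (A ∪ B)
    full-positive : ¬ Small full
    base          : ℕ → Subset I
    base-small    : ∀ j → Small (base j)
    small⇒⊆base   : ∀ {A} → Small A → Σ ℕ λ j → A ⊆ base j

  ∅-small : Small ∅
  ∅-small = ⊆-closed (λ _ ()) (base-small 0)

  ⋃<-small : (A : ℕ → Subset I) → ∀ n → (∀ k → k < n → Small (A k)) →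
             Small (λ i → Σ ℕ λ k → k < n × A k i)
  ⋃<-small A zero    _     = ⊆-closed (λ { _ (_ , () , _) }) ∅-small
  ⋃<-small A (suc n) small =
    ⊆-closed split (∪-closed (⋃<-small A n (λ k k<n → small k (m<n⇒m<1+n k<n))) (small n ≤-refl))
    where
    split : (λ i → Σ ℕ λ k → k < suc n × A k i) ⊆ ((λ i → Σ ℕ λ k → k < n × A k i) ∪ A n)
    split i (k , k<1+n , a) with m<1+n⇒m<n∨m≡n k<1+n
    ... | inj₁ k<n  = inj₁ (k , k<n , a)
    ... | inj₂ refl = inj₂ a

  escapes⇒positive : ∀ {A} → (∀ j → Σ I λ i → A i × ¬ base j i) → ¬ Small A
  escapes⇒positive escapes small with small⇒⊆base small
  ... | j , A⊆base with escapes j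
  ... | i , a , outside = outside (A⊆base i a)

fin-countablyGenerated : CountablyGeneratedIdeal finI
fin-countablyGenerated = record
  { ⊆-closed      = λ { A⊆B (n , B<n) → n , λ k a → B<n k (A⊆B k a) }
  ; ∪-closed      = λ { (n₁ , A<n₁) (n₂ , B<n₂) → n₁ ⊔ n₂ , λ
                        { k (inj₁ a) → <-≤-trans (A<n₁ k a) (m≤m⊔n n₁ n₂)
                        ; k (inj₂ b) → <-≤-trans (B<n₂ k b) (m≤n⊔m n₁ n₂) } }
  ; full-positive = λ { (n , <n) → <-irrefl refl (<n n tt) }
  ; base          = λ j k → k < j
  ; base-small    = λ j → j , λ _ k<j → k<j
  ; small⇒⊆base   = λ small → small
  }

record SelectorForcing {X : Set} (J : Subset X → Set) : Set₁ where
  field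
    ⊆-closed        : ∀ {A B} → A ⊆ B → J B → J A
    full-positive   : ¬ J full
    forces-selector : ∀ P → ¬ J P → (g : X → Pt) → (∀ u → InΔ (g u)) →
                      Forced (λ S → ¬ J (λ u → P u × S (g u)))

Lim : {I : Set} {Xs : I → Set} → (Subset I → Set) → ((i : I) → Subset (Xs i) → Set) → Subset (Σ I Xs) → Set
Lim Small J A = Small (λ i → ¬ J i (λ u → A (i , u)))

fin⁰-selectorForcing : SelectorForcing {⊤} (λ A → ∀ u → ¬ A u)
fin⁰-selectorForcing = record
  { ⊆-closed        = λ A⊆B noB u a → noB u (A⊆B u a)
  ; full-positive   = λ none → none tt tt
  ; forces-selector = λ P P-positive g gΔ →
      inj₁ (g tt , gΔ tt , λ none → P-positive (λ u Pu → none u (Pu , refl)))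
  }

module _ (em : ∀ {ℓ} → ExcludedMiddle ℓ) where

  private
    dne : ∀ {ℓ} {A : Set ℓ} → ¬ ¬ A → A
    dne = em⇒dne em

  module Gluing {I : Set} {Small : Subset I → Set} (𝓘 : CountablyGeneratedIdeal Small)
                (Q : Subset I) (Q-positive : ¬ Small Q)
                (T : I → Subset Pt → Set) (T-mono : ∀ i {S S′} → S ⊆ S′ → T i S → T i S′)
                (forced : ∀ i → Q i → Forced (T i)) where
    open CountablyGeneratedIdeal 𝓘

    Positive : Subset Pt → Set
    Positive S = ¬ Small (λ i → T i S)

    private
      positive⇒escapes : ∀ {A} → ¬ Small A → ∀ j → Σ I λ i → A i × ¬ base j i
      positive⇒escapes positive j =
        dne λ none → positive (⊆-closed (λ i a → dne λ outside → none (i , a , outside)) (base-small j))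

      WithPoint NoPoint : Subset I
      WithPoint i = Q i × ForcedByPoint (T i)
      NoPoint   i = Q i × ¬ ForcedByPoint (T i)

      sequences : ∀ {i} → NoPoint i → ForcedBySequences (T i)
      sequences {i} (q , no-point) with forced i q
      ... | inj₁ point = ⊥-elim (no-point point)
      ... | inj₂ seqs  = seqs

      from-sequences : ¬ Small NoPoint → ForcedBySequences Positive
      from-sequences positive =
        let R , R-column , forces = ForcedBySequences-⋂ (λ j → sequences (proj₁ (proj₂ (pick j))))
        in  R , R-column , λ S meets →
              escapes⇒positive λ j → proj₁ (pick j) , forces S meets j , proj₂ (proj₂ (pick j))
        where
        pick : ∀ j → Σ I λ i → NoPoint i × ¬ base j i
        pick = positive⇒escapes positive

      -- Without a positive singleton, only a small set of indices can force points in the first t columns,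
      -- so for each j and t some index outside base j forces a point in a column ≥ t.
      from-points : ¬ Small WithPoint → Forced Positive
      from-points positive with em {P = Σ Pt λ p → InΔ p × Positive (Singleton p)}
      ... | yes point    = inj₁ point
      ... | no  no-point = inj₂ (R , R-column , forces)
        where
        singleton-small : ∀ p → InΔ p → Small (λ i → T i (Singleton p))
        singleton-small p d = dne λ positive → no-point (p , d , positive)

        Near : ℕ → Subset I
        Near t i = Σ Pt λ p → InΔ p × column p < t × T i (Singleton p)

        Near-small : ∀ t → Small (Near t)
        Near-small t = ⊆-closed by-column
          (⋃<-small _ t λ k _ → ⋃<-small _ (suc k) λ l l<1+k → singleton-small (k , l) (m<1+n⇒m≤n l<1+k))
          where
          by-column : Near t ⊆ λ i → Σ ℕ λ k → k < t × Σ ℕ λ l → l < suc k × T i (Singleton (k , l))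
          by-column i ((k , l) , l≤k , k<t , forced-p) = k , k<t , l , s≤s l≤k , forced-p

        Far : ℕ → ℕ → Set
        Far j t = Σ I λ i → Σ Pt λ p → T i (Singleton p) × ¬ base j i × t ≤ column p

        far : ∀ j t → Far j t
        far j t = dne λ none → positive (⊆-closed (cover none) (∪-closed (base-small j) (Near-small t)))
          where
          cover : ¬ Far j t → WithPoint ⊆ (base j ∪ Near t)
          cover none i (_ , p , d , forced-p) with em {P = base j i}
          ... | yes inside  = inj₁ inside
          ... | no  outside = inj₂ (p , d , ≰⇒> (λ t≤ → none (i , p , forced-p , outside , t≤)) , forced-p)

        R : ℕ → ℕ → Pt
        R j t = proj₁ (proj₂ (far j t))

        R-column : ∀ j t → t ≤ column (R j t)
        R-column j t = proj₂ (proj₂ (proj₂ (proj₂ (far j t))))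

        forces : ∀ S → MeetsInfinitelyOften R S → Positive S
        forces S meets = escapes⇒positive λ j → hit j (meets j 0)
          where
          hit : ∀ j → (Σ ℕ λ t → 0 ≤ t × S (R j t)) → Σ I λ i → T i S × ¬ base j i
          hit j (t , _ , s) with far j t
          ... | i , p , forced-p , outside , _ = i , T-mono i (λ { _ refl → s }) forced-p , outside

    forced-positive : Forced Positive
    forced-positive with em {P = Small WithPoint}
    ... | no  positive = from-points positive
    ... | yes small    = inj₂ (from-sequences λ small′ → Q-positive (⊆-closed split (∪-closed small small′)))
      where
      split : Q ⊆ (WithPoint ∪ NoPoint)
      split i q with em {P = ForcedByPoint (T i)}
      ... | yes point    = inj₁ (q , point)
      ... | no  no-point = inj₂ (q , no-point)

  lim-selectorForcing : {I : Set} {Xs : I → Set} {Small : Subset I → Set} {J : (i : I) → Subset (Xs i) → Set} →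
    CountablyGeneratedIdeal Small → (∀ i → SelectorForcing (J i)) → SelectorForcing (Lim Small J)
  lim-selectorForcing {Small = Small} {J} 𝓘 𝓙 = record
    { ⊆-closed        = λ A⊆B →
        ⊆-closed (λ i ¬JA JB → ¬JA (SelectorForcing.⊆-closed (𝓙 i) (λ u → A⊆B (i , u)) JB))
    ; full-positive   = λ small → full-positive (⊆-closed (λ i _ → SelectorForcing.full-positive (𝓙 i)) small)
    ; forces-selector = λ P P-positive g gΔ →
        Gluing.forced-positive 𝓘 (λ i → ¬ J i (λ u → P (i , u))) P-positive
          (λ i S → ¬ J i (λ u → P (i , u) × S (g (i , u))))
          (λ i S⊆S′ ¬JS JS′ → ¬JS (SelectorForcing.⊆-closed (𝓙 i) (λ u (Pu , s) → Pu , S⊆S′ _ s) JS′))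
          (λ i Pᵢ-positive →
            SelectorForcing.forces-selector (𝓙 i) _ Pᵢ-positive (λ u → g (i , u)) (λ u → gΔ (i , u)))
    }
    where open CountablyGeneratedIdeal 𝓘

  fin-selectorForcing : SelectorForcing finI
  fin-selectorForcing = record
    { ⊆-closed        = CountablyGeneratedIdeal.⊆-closed fin-countablyGenerated
    ; full-positive   = CountablyGeneratedIdeal.full-positive fin-countablyGenerated
    ; forces-selector = λ P P-positive g gΔ →
        Gluing.forced-positive fin-countablyGenerated P P-positive (λ i S → P i × S (g i))
          (λ i S⊆S′ (Pi , s) → Pi , S⊆S′ _ s) (λ i Pi → inj₁ (g i , gΔ i , Pi , refl))
    }

  module _ (α : CountableOrdinal) where
    open CountableOrdinal α
    open FinHierarchy α

    -- The codes enc z of the ordinals z ≺ x enumerate a cofinal family of bounds.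
    bnd-countablyGenerated : (x : Carrier) → Σ Carrier (_≺ x) → CountablyGeneratedIdeal (bnd x)
    bnd-countablyGenerated x (z₀ , z₀≺x) = record
      { ⊆-closed      = λ { A⊆B (z , z≺x , B≺z) → z , z≺x , λ yp a → B≺z yp (A⊆B yp a) }
      ; ∪-closed      = ∪-closed
      ; full-positive = λ { (z , z≺x , ≺z) → ≺-irr z (≺z (z , z≺x) tt) }
      ; base          = base
      ; base-small    = base-small
      ; small⇒⊆base   = λ { (z , z≺x , A≺z) → enc z , λ yp a → z , z≺x , refl , A≺z yp a }
      }
      where
      ∪-closed : ∀ {A B} → bnd x A → bnd x B → bnd x (A ∪ B)
      ∪-closed (z₁ , z₁≺x , A≺z₁) (z₂ , z₂≺x , B≺z₂) with ≺-tri z₁ z₂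
      ... | inj₁ z₁≺z₂        =
        z₂ , z₂≺x , λ { yp (inj₁ a) → ≺-trans (A≺z₁ yp a) z₁≺z₂ ; yp (inj₂ b) → B≺z₂ yp b }
      ... | inj₂ (inj₁ refl) =
        z₁ , z₁≺x , λ { yp (inj₁ a) → A≺z₁ yp a ; yp (inj₂ b) → B≺z₂ yp b }
      ... | inj₂ (inj₂ z₂≺z₁) =
        z₁ , z₁≺x , λ { yp (inj₁ a) → A≺z₁ yp a ; yp (inj₂ b) → ≺-trans (B≺z₂ yp b) z₂≺z₁ }

      base : ℕ → Subset (Σ Carrier (_≺ x))
      base j yp = Σ Carrier λ z → z ≺ x × enc z ≡ j × proj₁ yp ≺ z

      base-small : ∀ j → bnd x (base j)
      base-small j with em {P = Σ Carrier λ z → z ≺ x × enc z ≡ j}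
      ... | yes (z , z≺x , refl) =
        z , z≺x , λ { yp (z′ , _ , enc≡ , y≺z′) → subst (proj₁ yp ≺_) (enc-inj enc≡) y≺z′ }
      ... | no  no-code          =
        z₀ , z₀≺x , λ { yp (z′ , z′≺x , enc≡ , _) → ⊥-elim (no-code (z′ , z′≺x , enc≡)) }

    FinI-selectorForcing : ∀ x (a : Acc _≺_ x) → SelectorForcing (FinI x a)
    FinI-selectorForcing x (acc rs) with kind x
    ... | isZero _    = fin⁰-selectorForcing
    ... | isLim z₀ _  = lim-selectorForcing (bnd-countablyGenerated x z₀)
                          λ yp → FinI-selectorForcing (proj₁ yp) (rs (proj₂ yp))
    ... | isSuc y p _ with kind y
    ...   | isZero _    = fin-selectorForcing
    ...   | isSuc _ _ _ = lim-selectorForcing fin-countablyGenerated λ _ → FinI-selectorForcing y (rs p)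
    ...   | isLim _ _   = lim-selectorForcing fin-countablyGenerated λ _ → FinI-selectorForcing y (rs p)

  EDfin-≰K-fin : (α : CountableOrdinal) → ¬ (EDfin ≤K finα α)
  EDfin-≰K-fin α (f , preimage-small) =
    let S , S-selector , positive =
          Forced⇒selector (forces-selector full full-positive (λ u → proj₁ (f u)) (λ u → proj₂ (f u)))
    in  positive (⊆-closed (λ _ → proj₂) (preimage-small _ (selector-EDfin S-selector)))
    where
    open CountableOrdinal α using (top; ≺-wf)
    open SelectorForcing (FinI-selectorForcing α top (≺-wf top))


Image-preimage-⊆ : {X Y : Set} (f : X → Y) (B : Subset Y) → Image f (λ x → B (f x)) ⊆ B
Image-preimage-⊆ f B _ (x , Bfx , refl) = Bfx

images-isIdeal : {X Y : Set} {ℓ : Level} {J : Subset Y → Set ℓ} → IsIdeal J → (f : X → Y) →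
                 IsIdeal (λ A → J (Image f A))
images-isIdeal (⊆-closed , ∅-small , ∪-closed) f =
    (λ A B A⊆B → ⊆-closed _ _ (λ { y (x , a , fx≡y) → x , A⊆B x a , fx≡y }))
  , ⊆-closed _ _ (λ { _ (_ , () , _) }) ∅-small
  , λ A B JA JB → ⊆-closed _ _ (λ { y (x , inj₁ a , fx≡y) → inj₁ (x , a , fx≡y)
                                  ; y (x , inj₂ b , fx≡y) → inj₂ (x , b , fx≡y) }) (∪-closed _ _ JA JB)

Picks : ∀ {n} → ℕ → (Fin n → Set) → Set
Picks {n} m P = Σ (Fin m → Fin n) λ e → Injective _≡_ _≡_ e × ∀ i → P (e i)

private
  picks-none : ∀ {n} (P : Fin n → Set) → Picks 0 P
  picks-none P = (λ ()) , (λ { {()} }) , λ ()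

  picks-tail : ∀ {n m} {P : Fin (suc n) → Set} → Picks m (λ i → P (Fin.suc i)) → Picks m P
  picks-tail (e , e-inj , Pe) = (λ i → Fin.suc (e i)) , (λ eq → e-inj (Fin.suc-injective eq)) , Pe

  picks-cons : ∀ {n m} {P : Fin (suc n) → Set} → P Fin.zero → Picks m (λ i → P (Fin.suc i)) → Picks (suc m) P
  picks-cons P0 (e , e-inj , Pe) =
    Fin.lift 1 e , Fin.lift-injective e e-inj 1 , λ { Fin.zero → P0 ; (Fin.suc i) → Pe i }

picks-split : ∀ {n} m₁ m₂ → m₁ + m₂ ≤ n → (P Q : Fin n → Set) → (∀ i → P i ⊎ Q i) →
              Picks m₁ P ⊎ Picks m₂ Q
picks-split zero     _        _        P _ _ = inj₁ (picks-none P)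
picks-split (suc _)  zero     _        _ Q _ = inj₂ (picks-none Q)
picks-split {suc n} (suc m₁) (suc m₂) (s≤s m₁+m₂<n) P Q P∪Q with P∪Q Fin.zero
... | inj₁ P0 = Sum.map (picks-cons {P = P} P0) (picks-tail {P = Q})
  (picks-split m₁ (suc m₂) m₁+m₂<n _ _ (λ i → P∪Q (Fin.suc i)))
... | inj₂ Q0 = Sum.map (picks-tail {P = P}) (picks-cons {P = Q} Q0)
  (picks-split (suc m₁) m₂ (subst (_≤ n) (+-suc m₁ m₂) m₁+m₂<n) _ _ (λ i → P∪Q (Fin.suc i)))

FewerThan-⊆ : ∀ {m} {A B : Subset ℕ} → A ⊆ B → FewerThan m B → FewerThan m A
FewerThan-⊆ A⊆B fewer g g-inj in-A = fewer g g-inj (λ i → A⊆B _ (in-A i))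

FewerThan-∪ : ∀ {m₁ m₂} {A B : Subset ℕ} → FewerThan m₁ A → FewerThan m₂ B → FewerThan (m₁ + m₂) (A ∪ B)
FewerThan-∪ {m₁} {m₂} {A} {B} fewer-A fewer-B g g-inj in-A∪B
  with picks-split m₁ m₂ ≤-refl (λ i → A (g i)) (λ i → B (g i)) in-A∪B
... | inj₁ (e , e-inj , in-A) = fewer-A (λ i → g (e i)) (λ eq → e-inj (g-inj eq)) in-A
... | inj₂ (e , e-inj , in-B) = fewer-B (λ i → g (e i)) (λ eq → e-inj (g-inj eq)) in-B

ED-⊆-closed : ∀ A B → A ⊆ B → ED B → ED A
ED-⊆-closed A B A⊆B (m , n , fewer) = m , n , λ k n<k → FewerThan-⊆ (λ l → A⊆B (k , l)) (fewer k n<k)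

ED-∪-closed : ∀ A B → ED A → ED B → ED (A ∪ B)
ED-∪-closed A B (m₁ , n₁ , fewer-A) (m₂ , n₂ , fewer-B) = m₁ + m₂ , n₁ ⊔ n₂ , λ k n<k →
  FewerThan-∪ {A = λ l → A (k , l)} {B = λ l → B (k , l)}
    (fewer-A k (≤-<-trans (m≤m⊔n n₁ n₂) n<k)) (fewer-B k (≤-<-trans (m≤n⊔m n₁ n₂) n<k))

EDfin-⊆-closed : ∀ A B → A ⊆ B → EDfin B → EDfin A
EDfin-⊆-closed A B A⊆B (C , C-ED , B⇔C) =
  A′ , ED-⊆-closed A′ C A′⊆C C-ED , λ p → mk⇔ (λ a → proj₂ p , a) (from p)
  where
  A′ : Subset Pt
  A′ q = Σ (InΔ q) λ d → A (q , d)
  A′⊆C : A′ ⊆ C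
  A′⊆C q (d , a) = Equivalence.to (B⇔C (q , d)) (A⊆B _ a)
  from : ∀ p → A′ (proj₁ p) → A p
  from p (d , a) = subst A (Δ-≡ refl) a

EDfin-∪-closed : ∀ A B → EDfin A → EDfin B → EDfin (A ∪ B)
EDfin-∪-closed A B (C , C-ED , A⇔C) (D , D-ED , B⇔D) = C ∪ D , ED-∪-closed C D C-ED D-ED , λ p →
  mk⇔ (Sum.map (Equivalence.to (A⇔C p)) (Equivalence.to (B⇔D p)))
      (Sum.map (Equivalence.from (A⇔C p)) (Equivalence.from (B⇔D p)))

EDfin-isIdeal : IsIdeal EDfin
EDfin-isIdeal = EDfin-⊆-closed , selector-EDfin {S = ∅} (λ _ _ _ ()) , EDfin-∪-closed

maximum-attained : ∀ {m} (g : Fin (suc m) → ℕ) → Σ (Fin (suc m)) λ i → ∀ j → g j ≤ g i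
maximum-attained {m} g = last , λ j → All.lookup (f[xs]≤f[argmax] {f = g} Fin.zero (allFin (suc m))) (∈-allFin j)
  where
  last : Fin (suc m)
  last = argmax g Fin.zero (allFin (suc m))

does-true⇒ : {P : Set} (P? : Dec P) → does P? ≡ true → P
does-true⇒ (yes p) _ = p

indicator : {P : Set} → Dec P → ℕ
indicator (yes _) = 1
indicator (no _)  = 0

indicator-≡1 : {P : Set} (P? : Dec P) → indicator P? ≡ 1 ⇔ P
indicator-≡1 (yes p)  = mk⇔ (λ _ → p) (λ _ → refl)
indicator-≡1 (no ¬p) = mk⇔ (λ ()) (λ p → ⊥-elim (¬p p))

module _ (f : ℕ → Δ) where

  point : ℕ → Pt
  point j = proj₁ (f j)

  RowsUpTo : Subset ℕ → ℕ → ℕ → Subset ℕ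
  RowsUpTo A n k l = Σ ℕ λ j → j ≤ n × A j × point j ≡ (k , l)

  Admissible : ℕ → ℕ → Subset ℕ → Subset ℕ
  Admissible m n₀ A n = A n × (column (point n) ≤ n₀ ⊎ FewerThan m (RowsUpTo A n (column (point n))))

  Admissible-cong : ∀ {m n₀ A B n} → (∀ j → j ≤ n → A j ⇔ B j) → Admissible m n₀ A n → Admissible m n₀ B n
  Admissible-cong A⇔B (a , inj₁ low)   = Equivalence.to (A⇔B _ ≤-refl) a , inj₁ low
  Admissible-cong A⇔B (a , inj₂ fewer) = Equivalence.to (A⇔B _ ≤-refl) a , inj₂ (FewerThan-⊆ rows fewer)
    where
    rows : RowsUpTo _ _ _ ⊆ RowsUpTo _ _ _
    rows l (j , j≤n , b , eq) = j , j≤n , Equivalence.from (A⇔B j j≤n) b , eq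


-- A code x stores the ED-bounds m = x 0 and n₀ = x 1 and the set A as {j : x (2 + j) ≡ 1}.
Member : (ℕ → ℕ) → Subset ℕ
Member x j = x (2 + j) ≡ 1

module _ (em : ∀ {ℓ} → ExcludedMiddle ℓ) (f : ℕ → Δ) where

  decode : (ℕ → ℕ) → ℕ → Bool
  decode x n = does (em {P = Admissible f (x 0) (x 1) (Member x) n})

  decode-continuous : Continuous decode
  decode-continuous x n = 3 + n , λ y x≡y →
    does-⇔ (mk⇔ (transport x≡y) (transport (λ i i<3+n → sym (x≡y i i<3+n)))) em em
    where
    transport : ∀ {x y} → (∀ i → i < 3 + n → x i ≡ y i) →
                Admissible f (x 0) (x 1) (Member x) n → Admissible f (y 0) (y 1) (Member y) n
    transport {x} {y} x≡y admissible =
      subst₂ (λ m n₀ → Admissible f m n₀ (Member y) n) (x≡y 0 (s≤s z≤n)) (x≡y 1 (s≤s (s≤s z≤n)))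
        (Admissible-cong f (λ j j≤n → let eq = x≡y (2 + j) (s≤s (s≤s (s≤s j≤n)))
                                      in  mk⇔ (trans (sym eq)) (trans eq))
          admissible)

  encode : ℕ → ℕ → Subset ℕ → ℕ → ℕ
  encode m n₀ A zero          = m
  encode m n₀ A (suc zero)    = n₀
  encode m n₀ A (suc (suc j)) = indicator (em {P = A j})

  image-coded : ∀ A → EDfin (Image f A) → Σ (ℕ → ℕ) λ x → ∀ n → A n ⇔ (decode x n ≡ true)
  image-coded A (C , (m , n₀ , fewer) , image⇔C) = x , λ n →
    mk⇔ (λ a → dec-true em (admissible n a))
        (λ decoded → Equivalence.to (member⇔ n) (proj₁ (does-true⇒ em decoded)))
    where
    x : ℕ → ℕ
    x = encode m n₀ A
    member⇔ : ∀ j → Member x j ⇔ A j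
    member⇔ j = indicator-≡1 em
    image⊆C : ∀ j → A j → C (point f j)
    image⊆C j a = Equivalence.to (image⇔C (f j)) (j , a , refl)
    admissible : ∀ n → A n → Admissible f m n₀ (Member x) n
    admissible n a with column (point f n) ≤? n₀
    ... | yes low  = Equivalence.from (member⇔ n) a , inj₁ low
    ... | no  high = Equivalence.from (member⇔ n) a , inj₂ (FewerThan-⊆ rows⊆C (fewer _ (≰⇒> high)))
      where
      rows⊆C : RowsUpTo f (Member x) n (column (point f n)) ⊆ (λ l → C (column (point f n) , l))
      rows⊆C l (j , _ , member , eq) = subst C eq (image⊆C j (Equivalence.to (member⇔ j) member))

  -- A column k > x 1 holding 1 + x 0 rows of the image has a latest contributing index n;
  -- admissibility of n allows at most x 0 of them.
  coded-image : ∀ A → (Σ (ℕ → ℕ) λ x → ∀ n → A n ⇔ (decode x n ≡ true)) → EDfin (Image f A)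
  coded-image A (x , A⇔decoded) = C , (suc (x 0) , x 1 , fewer) , image⇔C
    where
    C : Subset Pt
    C q = Σ ℕ λ j → A j × point f j ≡ q

    image⇔C : ∀ p → Image f A p ⇔ C (proj₁ p)
    image⇔C p = mk⇔ (λ { (j , a , refl) → j , a , refl }) (λ { (j , a , eq) → j , a , Δ-≡ eq })

    admissible : ∀ n → A n → Admissible f (x 0) (x 1) (Member x) n
    admissible n a = does-true⇒ em (Equivalence.to (A⇔decoded n) a)

    fewer : ∀ k → x 1 < k → FewerThan (suc (x 0)) (λ l → C (k , l))
    fewer k x₁<k rows rows-inj in-C with maximum-attained (λ t → proj₁ (in-C t))
    ... | last , ≤last with in-C last
    ...   | n , a , n↦k with admissible n a
    ...     | _ , inj₁ low = <-irrefl refl (≤-<-trans (subst (_≤ x 1) (cong column n↦k) low) x₁<k)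
    ...     | _ , inj₂ few =
      few (λ t → rows (Fin.suc t)) (λ eq → Fin.suc-injective (rows-inj eq)) λ t → contributes (Fin.suc t)
      where
      contributes : ∀ t → RowsUpTo f (Member x) n (column (point f n)) (rows t)
      contributes t = let j , a , j↦k = in-C t in
        j , ≤last t , proj₁ (admissible j a) , trans j↦k (cong (_, rows t) (sym (cong column n↦k)))

  images-analytic : Analytic (λ A → EDfin (Image f A))
  images-analytic = decode , decode-continuous , λ A → mk⇔ (image-coded A) (coded-image A)

shelah⇒EDfin-ultrafilter : (∀ {ℓ} → ExcludedMiddle ℓ) →
  (U : Subset ℕ → Set₁) → IsShelah U → IsIUltrafilter EDfin U
shelah⇒EDfin-ultrafilter em U (_ , _ , below-analytic) f with em {P = Σ (Subset ℕ) λ A → U A × EDfin (Image f A)}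
... | yes found = found
... | no  none
  with below-analytic _ (images-isIdeal EDfin-isIdeal f) (images-analytic em f) (λ A small big → none (A , big , small))
...   | α , J , _ , ((g , g-reduces) , _) , images⊑J , _ = ⊥-elim (EDfin-≰K-fin em α ((λ u → f (g u)) , reduces))
  where
  reduces : ∀ B → EDfin B → finα α (λ u → B (f (g u)))
  reduces B B-small = g-reduces _ (images⊑J _ (EDfin-⊆-closed _ B (Image-preimage-⊆ f B) B-small))

mainTheorem16 : (∀ {ℓ : Level} → ExcludedMiddle ℓ) →
    ((α : CountableOrdinal) → ¬ (EDfin ≤K finα α)) ×
    ((U : Subset ℕ → Set₁) → IsShelah U → IsIUltrafilter EDfin U)
mainTheorem16 em = EDfin-≰K-fin em , shelah⇒EDfin-ultrafilter em
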